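{- Let $d,n$ be integers with $d\geq1$ and $n\geq1$. (1) If $n\leq d$, then $\mathrm{gp}^3_d(P_n\,\Box\,P_2)=2$ if $n=1$, and $\mathrm{gp}^3_d(P_n\,\Box\,P_2)=\min(n,3)$ if $n\geq2$. (2) If $n\geq d+1$, then $\mathrm{gp}^3_d(P_n\,\Box\,P_2)=2\lfloor n/2\rfloor+2\min(n\bmod 2,1)$ if $d=2$, and $\mathrm{gp}^3_d(P_n\,\Box\,P_2)=3\lfloor n/d\rfloor+\min(n\bmod d,3)$ if $d\geq3$.
   Context: $P_n\,\Box\,P_2$ is the grid with vertex set $\{1,\ldots,n\}\times\{1,2\}$, where $(i,j)$ and $(i',j')$ are adjacent iff either $j=j'$ and $|i-i'|=1$, or $i=i'$ and $j\neq j'$. For a graph $G$, a geodesic is a shortest path between two vertices; its length $\lambda(g)$ is its number of edges. For $d\ge1$, $k\ge2$, $S\subseteq V(G)$ is a $k$-general $d$-position set if every geodesic $g$ with $|S\cap V(g)|\geq k$ has $\lambda(g)>d$; $\mathrm{gp}^k_d(G)$ is the largest cardinality of such a set. -}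

module Defs where

open import Data.Nat using (ℕ; zero; suc; _≤_; _<_; _∸_)
open import Data.Fin using (Fin; toℕ)
open import Data.List using (List; []; _∷_; length)
open import Data.List.Membership.Propositional using (_∈_)
open import Data.List.Relation.Unary.All using (All)
open import Data.List.Relation.Unary.Unique.Propositional using (Unique)
open import Data.Product using (Σ; _×_; ∃)
open import Data.Sum using (_⊎_)
open import Relation.Binary.PropositionalEquality using (_≡_; _≢_)

record Graph : Set₁ where
  field
    V   : Set
    Adj : V → V → Set
open Graph public

data Walk (G : Graph) : V G → V G → List (V G) → Set where
  single : ∀ u → Walk G u u (u ∷ [])
  step   : ∀ {u w v vs} → Adj G u w → Walk G w v vs → Walk G u v (u ∷ vs)

-- number of edges of a path given by its vertex list
len : ∀ {A : Set} → List A → ℕ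
len vs = length vs ∸ 1

IsPath : (G : Graph) → V G → V G → List (V G) → Set
IsPath G u v vs = Walk G u v vs × Unique vs

Geodesic : (G : Graph) → V G → V G → List (V G) → Set
Geodesic G u v vs =
  IsPath G u v vs × (∀ ws → IsPath G u v ws → len vs ≤ len ws)

-- |S ∩ V(g)| ≥ k : there are k distinct vertices lying both in S and on g
AtLeastCommon : ∀ {A : Set} → ℕ → List A → List A → Set
AtLeastCommon {A} k S g =
  Σ (List A) λ xs → Unique xs × length xs ≡ k × All (_∈ S) xs × All (_∈ g) xs

IsKGenDPos : (G : Graph) → ℕ → ℕ → List (V G) → Set
IsKGenDPos G k d S =
  ∀ u v g → Geodesic G u v g → AtLeastCommon k S g → d < len g

IsGp : ℕ → ℕ → Graph → ℕ → Set
IsGp k d G m =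
  (Σ (List (V G)) λ S → Unique S × IsKGenDPos G k d S × length S ≡ m)
  × (∀ S → Unique S → IsKGenDPos G k d S → length S ≤ m)

-- P_n □ P_2, vertices (i , j) with i ∈ {0..n-1}, j ∈ {0,1}
GridAdj : (n : ℕ) → Fin n × Fin 2 → Fin n × Fin 2 → Set
GridAdj n (i Data.Product., j) (i' Data.Product., j') =
  (j ≡ j' × (toℕ i' ≡ suc (toℕ i) ⊎ toℕ i ≡ suc (toℕ i')))
  ⊎ (i ≡ i' × j ≢ j')

Grid : ℕ → Graph
Grid n = record { V = Fin n × Fin 2 ; Adj = GridAdj n }

-- The ladder P_n □ P_2 is {0,…,n-1} × {0,1} with the taxicab distance δ, and a vertex lies on a
-- geodesic between two others exactly when it is metrically between them. So S is a 3-general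
-- d-position set iff no y ∈ S lies between two other x, z ∈ S with δ x z ≤ d. Within any d consecutive
-- columns S is then between-free, and a between-free set has at most three vertices: three in one row
-- are collinear, and with two in each row every vertex would have to lie strictly inside the column
-- interval of the other row's pair. For d ≥ 2 two consecutive columns hold at most two vertices, and
-- d + 1 consecutive columns at most four, since two vertices in the first column together with any
-- vertex of the next d - 1 columns form a short betweenness. Summing over blocks of d columns gives the
-- upper bounds; they are attained by three consecutive columns out of every d with alternating rows
-- (d ≥ 3), by both vertices of every other column (d = 2), and by one full column (n ≤ 2).

module Submission where

open import Defs
open import Data.Nat
  using (ℕ; zero; suc; _≤_; _<_; _+_; _*_; _∸_; _⊓_; _⊔_; ∣_-_∣; ⌊_/2⌋; NonZero; z≤n; s≤s; s≤s⁻¹; _≤?_; _<?_)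
open import Data.Nat.Properties hiding (_≟_)
open import Data.Nat.DivMod using (_/_; _%_; m≡m%n+[m/n]*n; m%n<n)
open import Data.Nat.Tactic.RingSolver using (solve-∀)
open import Algebra.Properties.CommutativeSemigroup +-commutativeSemigroup using (interchange)
open import Data.Fin using (Fin; zero; suc; toℕ; fromℕ<; _≟_)
open import Data.Fin.Properties using (toℕ-injective; toℕ<n; toℕ-fromℕ<; toℕ≤pred[n])
open import Data.List using (List; []; _∷_; length; filter; tabulate)
open import Data.List.Properties using (length-tabulate; filter-all; filter-none; filter-accept; filter-reject)
open import Data.List.Membership.Propositional.Properties using (∈-filter⁻; ∈-tabulate⁻)
open import Data.List.Membership.Propositional using (_∈_)
open import Data.List.Relation.Unary.Any using (here; there)
open import Data.List.Relation.Unary.All as All using ([]; _∷_)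
open import Data.List.Relation.Unary.AllPairs using ([]; _∷_)
open import Data.List.Relation.Unary.Unique.Propositional using (Unique)
import Data.List.Relation.Unary.Unique.Propositional.Properties as Unique
open import Data.Product using (Σ; _×_; _,_; proj₁; proj₂; ∃)
open import Data.Sum using (_⊎_; inj₁; inj₂; swap)
import Data.Sum as Sum
open import Data.Empty using (⊥; ⊥-elim)
open import Relation.Nullary using (¬_; Dec; yes; no)
open import Relation.Nullary.Decidable using (_×-dec_)
open import Relation.Binary.Definitions using (tri<; tri≈; tri>)
open import Function using (_∘_)
open import Relation.Binary.PropositionalEquality
  using (_≡_; _≢_; ≢-sym; refl; sym; trans; cong; cong₂; subst; module ≡-Reasoning)

-- Betweenness on ℕ

record Betweenℕ (a b c : ℕ) : Set where
  constructor betweenℕ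
  field ∣-∣-additive : ∣ a - b ∣ + ∣ b - c ∣ ≡ ∣ a - c ∣
open Betweenℕ

StrictlyBetween : ℕ → ℕ → ℕ → Set
StrictlyBetween a b c = (a < b × b < c) ⊎ (c < b × b < a)

Betweenℕ-cong : ∀ {a a′ b b′ c c′} → a ≡ a′ → b ≡ b′ → c ≡ c′ → Betweenℕ a b c → Betweenℕ a′ b′ c′
Betweenℕ-cong refl refl refl h = h

Betweenℕ-sym : ∀ {a b c} → Betweenℕ a b c → Betweenℕ c b a
Betweenℕ-sym {a} {b} {c} (betweenℕ h) = betweenℕ (begin
  ∣ c - b ∣ + ∣ b - a ∣ ≡⟨ +-comm ∣ c - b ∣ _ ⟩
  ∣ b - a ∣ + ∣ c - b ∣ ≡⟨ cong₂ _+_ (∣-∣-comm b a) (∣-∣-comm c b) ⟩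
  ∣ a - b ∣ + ∣ b - c ∣ ≡⟨ h ⟩
  ∣ a - c ∣             ≡⟨ ∣-∣-comm a c ⟩
  ∣ c - a ∣             ∎)
  where open ≡-Reasoning

≤⇒Betweenℕ : ∀ {a b c} → a ≤ b → b ≤ c → Betweenℕ a b c
≤⇒Betweenℕ {a} {b} {c} a≤b b≤c = betweenℕ (begin
  ∣ a - b ∣ + ∣ b - c ∣ ≡⟨ cong₂ _+_ (m≤n⇒∣m-n∣≡n∸m a≤b) (m≤n⇒∣m-n∣≡n∸m b≤c) ⟩
  (b ∸ a) + (c ∸ b)     ≡⟨ +-comm (b ∸ a) (c ∸ b) ⟩
  (c ∸ b) + (b ∸ a)     ≡⟨ sym (+-∸-assoc (c ∸ b) a≤b) ⟩
  (c ∸ b + b) ∸ a       ≡⟨ cong (_∸ a) (m∸n+n≡m b≤c) ⟩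
  c ∸ a                 ≡⟨ sym (m≤n⇒∣m-n∣≡n∸m (≤-trans a≤b b≤c)) ⟩
  ∣ a - c ∣             ∎)
  where open ≡-Reasoning

StrictlyBetween⇒Betweenℕ : ∀ {a b c} → StrictlyBetween a b c → Betweenℕ a b c
StrictlyBetween⇒Betweenℕ (inj₁ (a<b , b<c)) = ≤⇒Betweenℕ (<⇒≤ a<b) (<⇒≤ b<c)
StrictlyBetween⇒Betweenℕ (inj₂ (c<b , b<a)) = Betweenℕ-sym (≤⇒Betweenℕ (<⇒≤ c<b) (<⇒≤ b<a))

Betweenℕ⇒≤ : ∀ {a b c} → Betweenℕ a b c → a ≤ c → a ≤ b × b ≤ c
Betweenℕ⇒≤ {a} {b} {c} (betweenℕ h) a≤c = ≮⇒≥ b≮a , ≮⇒≥ c≮b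
  where
    open ≤-Reasoning
    b≮a : ¬ b < a
    b≮a b<a = <-irrefl refl (begin-strict
      ∣ a - c ∣             ≡⟨ m≤n⇒∣m-n∣≡n∸m a≤c ⟩
      c ∸ a                 <⟨ ∸-monoʳ-< b<a a≤c ⟩
      c ∸ b                 ≤⟨ m∸n≤∣m-n∣ c b ⟩
      ∣ c - b ∣             ≡⟨ ∣-∣-comm c b ⟩
      ∣ b - c ∣             ≤⟨ m≤n+m _ _ ⟩
      ∣ a - b ∣ + ∣ b - c ∣ ≡⟨ h ⟩
      ∣ a - c ∣             ∎)
    c≮b : ¬ c < b
    c≮b c<b = <-irrefl refl (begin-strict
      ∣ a - c ∣             ≡⟨ m≤n⇒∣m-n∣≡n∸m a≤c ⟩
      c ∸ a                 <⟨ ∸-monoˡ-< c<b a≤c ⟩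
      b ∸ a                 ≤⟨ m∸n≤∣m-n∣ b a ⟩
      ∣ b - a ∣             ≡⟨ ∣-∣-comm b a ⟩
      ∣ a - b ∣             ≤⟨ m≤m+n _ _ ⟩
      ∣ a - b ∣ + ∣ b - c ∣ ≡⟨ h ⟩
      ∣ a - c ∣             ∎)

Betweenℕ-self : ∀ {a b} → Betweenℕ a b a → b ≡ a
Betweenℕ-self {a} h = sym (≤-antisym (proj₁ (Betweenℕ⇒≤ h ≤-refl)) (proj₂ (Betweenℕ⇒≤ h ≤-refl)))

StrictlyBetween-sym : ∀ {a b c} → StrictlyBetween a b c → StrictlyBetween c b a
StrictlyBetween-sym = swap

inside-or-beyond-≤ : ∀ {a b} c → a ≤ b → StrictlyBetween a c b ⊎ Betweenℕ c a b ⊎ Betweenℕ c b a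
inside-or-beyond-≤ {a} {b} c a≤b with c ≤? a | b ≤? c
... | yes c≤a | _       = inj₂ (inj₁ (≤⇒Betweenℕ c≤a a≤b))
... | no _    | yes b≤c = inj₂ (inj₂ (Betweenℕ-sym (≤⇒Betweenℕ a≤b b≤c)))
... | no c≰a  | no b≰c  = inj₁ (inj₁ (≰⇒> c≰a , ≰⇒> b≰c))

inside-or-beyond : ∀ a b c → StrictlyBetween a c b ⊎ Betweenℕ c a b ⊎ Betweenℕ c b a
inside-or-beyond a b c with ≤-total a b
... | inj₁ a≤b = inside-or-beyond-≤ c a≤b
... | inj₂ b≤a = Sum.map StrictlyBetween-sym swap (inside-or-beyond-≤ c b≤a)

one-between : ∀ a b c → Betweenℕ b a c ⊎ Betweenℕ a b c ⊎ Betweenℕ a c b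
one-between a b c with inside-or-beyond a b c
... | inj₁ a<c<b        = inj₂ (inj₂ (StrictlyBetween⇒Betweenℕ a<c<b))
... | inj₂ (inj₁ c-a-b) = inj₁ (Betweenℕ-sym c-a-b)
... | inj₂ (inj₂ c-b-a) = inj₂ (inj₁ (Betweenℕ-sym c-b-a))

StrictlyBetween⇒≢ : ∀ {a b c} → StrictlyBetween a b c → a ≢ b × b ≢ c
StrictlyBetween⇒≢ (inj₁ (a<b , b<c)) = <⇒≢ a<b , <⇒≢ b<c
StrictlyBetween⇒≢ (inj₂ (c<b , b<a)) = ≢-sym (<⇒≢ b<a) , ≢-sym (<⇒≢ c<b)

1≤∣-∣ : ∀ {a b} → a ≢ b → 1 ≤ ∣ a - b ∣
1≤∣-∣ a≢b = n≢0⇒n>0 (a≢b ∘ ∣m-n∣≡0⇒m≡n)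

StrictlyBetween⇒2≤∣-∣ : ∀ {a b c} → StrictlyBetween a b c → 2 ≤ ∣ a - c ∣
StrictlyBetween⇒2≤∣-∣ h with StrictlyBetween⇒≢ h
... | a≢b , b≢c =
  subst (2 ≤_) (∣-∣-additive (StrictlyBetween⇒Betweenℕ h)) (+-mono-≤ (1≤∣-∣ a≢b) (1≤∣-∣ b≢c))

StrictlyBetween-nested : ∀ {a b c e} → StrictlyBetween a c b → StrictlyBetween a e b → ¬ StrictlyBetween c a e
StrictlyBetween-nested (inj₁ (a<c , _)) _ (inj₁ (c<a , _)) = <-asym a<c c<a
StrictlyBetween-nested (inj₁ _) (inj₁ (a<e , _)) (inj₂ (e<a , _)) = <-asym a<e e<a
StrictlyBetween-nested (inj₁ (a<c , c<b)) (inj₂ (b<e , _)) (inj₂ (e<a , _)) =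
  <-asym a<c (<-trans c<b (<-trans b<e e<a))
StrictlyBetween-nested (inj₂ (_ , c<a)) _ (inj₂ (_ , a<c)) = <-asym a<c c<a
StrictlyBetween-nested (inj₂ _) (inj₂ (_ , e<a)) (inj₁ (_ , a<e)) = <-asym a<e e<a
StrictlyBetween-nested (inj₂ (b<c , c<a)) (inj₁ (a<e , e<b)) (inj₁ _) =
  <-asym a<e (<-trans e<b (<-trans b<c c<a))

∣-∣≡1 : ∀ {a c} → c ≡ suc a ⊎ a ≡ suc c → ∣ a - c ∣ ≡ 1
∣-∣≡1 {a} (inj₁ refl) = subst (λ x → ∣ a - x ∣ ≡ 1) (+-comm a 1) (∣m-m+n∣≡n a 1)
∣-∣≡1 {c = c} (inj₂ refl) = trans (∣-∣-comm (suc c) c) (∣-∣≡1 {c} (inj₁ refl))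

step-toward : ∀ a b → a ≢ b → ∃ λ c → ((c ≡ suc a × c ≤ b) ⊎ a ≡ suc c) × Betweenℕ a c b
step-toward a b a≢b with <-cmp a b
... | tri< a<b _ _ = suc a , inj₁ (refl , a<b) , ≤⇒Betweenℕ (n≤1+n a) a<b
... | tri≈ _ a≡b _ = ⊥-elim (a≢b a≡b)
step-toward (suc a) b _ | tri> _ _ (s≤s b≤a) =
  a , inj₂ refl , Betweenℕ-sym (≤⇒Betweenℕ b≤a (n≤1+n a))

+-≡-split : ∀ {a b c e} → c ≤ a → e ≤ b → a + b ≡ c + e → a ≡ c × b ≡ e
+-≡-split {a} {b} {c} {e} c≤a e≤b sum≡ =
  ≤-antisym (+-cancelʳ-≤ b a c (≤-trans (≤-reflexive sum≡) (+-monoʳ-≤ c e≤b))) c≤a ,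
  ≤-antisym (+-cancelˡ-≤ a b e (≤-trans (≤-reflexive sum≡) (+-monoˡ-≤ e c≤a))) e≤b

∣-∣<width : ∀ {lo w a b} → lo ≤ a → a < lo + w → lo ≤ b → b < lo + w → ∣ a - b ∣ < w
∣-∣<width {lo} {w} {a} {b} lo≤a a<lo+w lo≤b b<lo+w = begin-strict
  ∣ a - b ∣                           ≡⟨ sym (cong₂ ∣_-_∣ (m+[n∸m]≡n lo≤a) (m+[n∸m]≡n lo≤b)) ⟩
  ∣ lo + (a ∸ lo) - lo + (b ∸ lo) ∣   ≡⟨ ∣m+n-m+o∣≡∣n-o∣ lo (a ∸ lo) (b ∸ lo) ⟩
  ∣ a ∸ lo - b ∸ lo ∣                 ≤⟨ ∣m-n∣≤m⊔n (a ∸ lo) (b ∸ lo) ⟩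
  (a ∸ lo) ⊔ (b ∸ lo)                 <⟨ ⊔-lub (offset<w a<lo+w lo≤a) (offset<w b<lo+w lo≤b) ⟩
  w                                   ∎
  where
    open ≤-Reasoning
    offset<w : ∀ {x} → x < lo + w → lo ≤ x → x ∸ lo < w
    offset<w x<lo+w lo≤x = ≤-trans (∸-monoˡ-< x<lo+w lo≤x) (≤-reflexive (m+n∸m≡n lo w))

module _ {A : Set} where

  no-distinct-triple⇒length≤2 : ∀ {T : List A} → Unique T →
    (∀ {a b c} → a ∈ T → b ∈ T → c ∈ T → a ≢ b → a ≢ c → b ≢ c → ⊥) → length T ≤ 2
  no-distinct-triple⇒length≤2 {[]} _ _ = z≤n
  no-distinct-triple⇒length≤2 {_ ∷ []} _ _ = s≤s z≤n
  no-distinct-triple⇒length≤2 {_ ∷ _ ∷ []} _ _ = s≤s (s≤s z≤n)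
  no-distinct-triple⇒length≤2 {_ ∷ _ ∷ _ ∷ _} ((a≢b ∷ a≢c ∷ _) ∷ (b≢c ∷ _) ∷ _) no-triple =
    ⊥-elim (no-triple (here refl) (there (here refl)) (there (there (here refl))) a≢b a≢c b≢c)

  no-distinct-quadruple⇒length≤3 : ∀ {T : List A} → Unique T →
    (∀ {a b c e} → a ∈ T → b ∈ T → c ∈ T → e ∈ T → a ≢ b → a ≢ c → a ≢ e → b ≢ c → b ≢ e → c ≢ e → ⊥) →
    length T ≤ 3
  no-distinct-quadruple⇒length≤3 {[]} _ _ = z≤n
  no-distinct-quadruple⇒length≤3 {_ ∷ []} _ _ = s≤s z≤n
  no-distinct-quadruple⇒length≤3 {_ ∷ _ ∷ []} _ _ = s≤s (s≤s z≤n)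
  no-distinct-quadruple⇒length≤3 {_ ∷ _ ∷ _ ∷ []} _ _ = s≤s (s≤s (s≤s z≤n))
  no-distinct-quadruple⇒length≤3 {_ ∷ _ ∷ _ ∷ _ ∷ _}
    ((a≢b ∷ a≢c ∷ a≢e ∷ _) ∷ (b≢c ∷ b≢e ∷ _) ∷ (c≢e ∷ _) ∷ _) no-quadruple =
    ⊥-elim (no-quadruple (here refl) (there (here refl)) (there (there (here refl))) (there (there (there (here refl))))
                         a≢b a≢c a≢e b≢c b≢e c≢e)

  member-of-nonempty : ∀ {T : List A} → 1 ≤ length T → ∃ λ a → a ∈ T
  member-of-nonempty {a ∷ _} _ = a , here refl

  two-distinct-members : ∀ {T : List A} → Unique T → 2 ≤ length T → ∃ λ a → ∃ λ b → a ∈ T × b ∈ T × a ≢ b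
  two-distinct-members {a ∷ b ∷ _} ((a≢b ∷ _) ∷ _) _ = a , b , here refl , there (here refl) , a≢b
  two-distinct-members {_ ∷ []} _ (s≤s ())

module _ {G : Graph} where

  head∈ : ∀ {u v vs} → Walk G u v vs → u ∈ vs
  head∈ (single _) = here refl
  head∈ (step _ _) = here refl

  last∈ : ∀ {u v vs} → Walk G u v vs → v ∈ vs
  last∈ (single _) = here refl
  last∈ (step _ p) = there (last∈ p)

  len-∷ : ∀ {w v vs} (u : V G) → Walk G w v vs → len (u ∷ vs) ≡ suc (len vs)
  len-∷ u (single _) = refl
  len-∷ u (step _ _) = refl

  walk-++ : ∀ {u w v xs ys} → Walk G u w xs → Walk G w v ys →
            Σ (List (V G)) λ zs → Walk G u v zs × len zs ≡ len xs + len ys × w ∈ zs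
  walk-++ {ys = ys} (single _) q = ys , q , refl , head∈ q
  walk-++ (step {u = u} adj p) q with walk-++ p q
  ... | zs , r , len-zs , w∈zs =
    u ∷ zs , step adj r , trans (len-∷ u r) (trans (cong suc len-zs) (cong (_+ _) (sym (len-∷ u p)))) , there w∈zs

Fin2-pigeonhole : ∀ (i j k : Fin 2) → i ≢ j → k ≢ i → k ≡ j
Fin2-pigeonhole zero zero _ i≢j _ = ⊥-elim (i≢j refl)
Fin2-pigeonhole zero (suc zero) zero _ k≢i = ⊥-elim (k≢i refl)
Fin2-pigeonhole zero (suc zero) (suc zero) _ _ = refl
Fin2-pigeonhole (suc zero) zero zero _ _ = refl
Fin2-pigeonhole (suc zero) zero (suc zero) _ k≢i = ⊥-elim (k≢i refl)
Fin2-pigeonhole (suc zero) (suc zero) _ i≢j _ = ⊥-elim (i≢j refl)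

Fin2-Betweenℕ : ∀ (i j k : Fin 2) → (i ≡ k → j ≡ i) → Betweenℕ (toℕ i) (toℕ j) (toℕ k)
Fin2-Betweenℕ zero zero _ _ = betweenℕ refl
Fin2-Betweenℕ zero (suc zero) zero i≡k⇒j≡i with () ← i≡k⇒j≡i refl
Fin2-Betweenℕ zero (suc zero) (suc zero) _ = betweenℕ refl
Fin2-Betweenℕ (suc zero) zero zero _ = betweenℕ refl
Fin2-Betweenℕ (suc zero) zero (suc zero) i≡k⇒j≡i with () ← i≡k⇒j≡i refl
Fin2-Betweenℕ (suc zero) (suc zero) _ _ = betweenℕ refl

Fin2-≢⇒∣-∣≡1 : ∀ {i j : Fin 2} → i ≢ j → ∣ toℕ i - toℕ j ∣ ≡ 1
Fin2-≢⇒∣-∣≡1 {zero} {zero} i≢j = ⊥-elim (i≢j refl)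
Fin2-≢⇒∣-∣≡1 {zero} {suc zero} _ = refl
Fin2-≢⇒∣-∣≡1 {suc zero} {zero} _ = refl
Fin2-≢⇒∣-∣≡1 {suc zero} {suc zero} i≢j = ⊥-elim (i≢j refl)

-- The ladder as ℕ × {0,1} with the taxicab metric

Cell : ℕ → Set
Cell n = Fin n × Fin 2

module _ {n : ℕ} where

  col row : Cell n → ℕ
  col = toℕ ∘ proj₁
  row = toℕ ∘ proj₂

  δ : Cell n → Cell n → ℕ
  δ p q = ∣ col p - col q ∣ + ∣ row p - row q ∣

  cell-≡ : ∀ {p q : Cell n} → col p ≡ col q → row p ≡ row q → p ≡ q
  cell-≡ c≡ r≡ = cong₂ _,_ (toℕ-injective c≡) (toℕ-injective r≡)

  δ-refl : ∀ p → δ p p ≡ 0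
  δ-refl p = cong₂ _+_ (∣n-n∣≡0 (col p)) (∣n-n∣≡0 (row p))

  δ-sym : ∀ p q → δ p q ≡ δ q p
  δ-sym p q = cong₂ _+_ (∣-∣-comm (col p) (col q)) (∣-∣-comm (row p) (row q))

  δ-triangle : ∀ p q s → δ p s ≤ δ p q + δ q s
  δ-triangle p q s = begin
    δ p s
      ≤⟨ +-mono-≤ (∣-∣-triangle (col p) (col q) (col s)) (∣-∣-triangle (row p) (row q) (row s)) ⟩
    (∣ col p - col q ∣ + ∣ col q - col s ∣) + (∣ row p - row q ∣ + ∣ row q - row s ∣)
      ≡⟨ interchange ∣ col p - col q ∣ ∣ col q - col s ∣ ∣ row p - row q ∣ ∣ row q - row s ∣ ⟩
    δ p q + δ q s
      ∎
    where open ≤-Reasoning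

  δ≡0⇒≡ : ∀ {p q} → δ p q ≡ 0 → p ≡ q
  δ≡0⇒≡ {p} {q} δ≡0 =
    cell-≡ (∣m-n∣≡0⇒m≡n (m+n≡0⇒m≡0 _ δ≡0)) (∣m-n∣≡0⇒m≡n (m+n≡0⇒n≡0 ∣ col p - col q ∣ δ≡0))

  ≢⇒1≤δ : ∀ {p q} → p ≢ q → 1 ≤ δ p q
  ≢⇒1≤δ p≢q = n≢0⇒n>0 (p≢q ∘ δ≡0⇒≡)

  record Between (x y z : Cell n) : Set where
    constructor between
    field δ-additive : δ x y + δ y z ≡ δ x z
  open Between public

  Between-sym : ∀ {x y z} → Between x y z → Between z y x
  Between-sym {x} {y} {z} (between h) = between (begin
    δ z y + δ y x ≡⟨ +-comm (δ z y) _ ⟩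
    δ y x + δ z y ≡⟨ cong₂ _+_ (δ-sym y x) (δ-sym z y) ⟩
    δ x y + δ y z ≡⟨ h ⟩
    δ x z         ≡⟨ δ-sym x z ⟩
    δ z x         ∎)
    where open ≡-Reasoning

  Between-self : ∀ {x y} → Between x y x → y ≡ x
  Between-self {x} {y} (between h) =
    sym (δ≡0⇒≡ (m+n≡0⇒m≡0 (δ x y) (trans h (δ-refl x))))

  Betweenℕ⇒Between : ∀ {x y z} → Betweenℕ (col x) (col y) (col z) → Betweenℕ (row x) (row y) (row z) →
                     Between x y z
  Betweenℕ⇒Between {x} {y} {z} (betweenℕ cols) (betweenℕ rows) = between (begin
    δ x y + δ y z
      ≡⟨ interchange ∣ col x - col y ∣ ∣ row x - row y ∣ ∣ col y - col z ∣ ∣ row y - row z ∣ ⟩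
    (∣ col x - col y ∣ + ∣ col y - col z ∣) + (∣ row x - row y ∣ + ∣ row y - row z ∣)
      ≡⟨ cong₂ _+_ cols rows ⟩
    δ x z
      ∎)
    where open ≡-Reasoning

  Between⇒Betweenℕ : ∀ {x y z} → Between x y z →
                     Betweenℕ (col x) (col y) (col z) × Betweenℕ (row x) (row y) (row z)
  Between⇒Betweenℕ {x} {y} {z} (between h) = betweenℕ (proj₁ split) , betweenℕ (proj₂ split)
    where
      split = +-≡-split (∣-∣-triangle (col x) (col y) (col z)) (∣-∣-triangle (row x) (row y) (row z))
        (trans (sym (interchange ∣ col x - col y ∣ ∣ row x - row y ∣ ∣ col y - col z ∣ ∣ row y - row z ∣)) h)

  Between⇒row-≡ : ∀ {x y z} → Between x y z → proj₂ x ≡ proj₂ z → proj₂ y ≡ proj₂ x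
  Between⇒row-≡ {x} {y} x-y-z refl = toℕ-injective (Betweenℕ-self (proj₂ (Between⇒Betweenℕ x-y-z)))

  cols⇒Between : ∀ {x y z} → Betweenℕ (col x) (col y) (col z) → (proj₂ x ≡ proj₂ z → proj₂ y ≡ proj₂ x) →
                 Between x y z
  cols⇒Between {x} {y} {z} cols rows = Betweenℕ⇒Between cols (Fin2-Betweenℕ (proj₂ x) (proj₂ y) (proj₂ z) rows)

  -- Geodesics, and 3-general d-position as a metric condition

  adjacent⇒δ≡1 : ∀ {u w} → GridAdj n u w → δ u w ≡ 1
  adjacent⇒δ≡1 {_ , r} (inj₁ (refl , succ)) = cong₂ _+_ (∣-∣≡1 succ) (∣n-n∣≡0 (toℕ r))
  adjacent⇒δ≡1 {i , _} (inj₂ (refl , r≢r′)) = cong₂ _+_ (∣n-n∣≡0 (toℕ i)) (Fin2-≢⇒∣-∣≡1 r≢r′)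

  δ-step : ∀ {u w} a → GridAdj n u w → δ u a ≤ suc (δ w a)
  δ-step {u} {w} a adj = ≤-trans (δ-triangle u w a) (≤-reflexive (cong (_+ δ w a) (adjacent⇒δ≡1 adj)))

  closer-neighbour : ∀ {u v} → u ≢ v → ∃ λ w → GridAdj n u w × suc (δ w v) ≡ δ u v
  closer-neighbour {i , a} {k , b} u≢v with a ≟ b
  ... | no a≢b = (i , b) , inj₂ (refl , a≢b) , (begin
    suc (∣ toℕ i - toℕ k ∣ + ∣ toℕ b - toℕ b ∣) ≡⟨ cong (λ x → suc (∣ toℕ i - toℕ k ∣ + x)) (∣n-n∣≡0 (toℕ b)) ⟩
    suc (∣ toℕ i - toℕ k ∣ + 0)                 ≡⟨ trans (cong suc (+-identityʳ _)) (+-comm 1 _) ⟩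
    ∣ toℕ i - toℕ k ∣ + 1                       ≡⟨ cong (∣ toℕ i - toℕ k ∣ +_) (sym (Fin2-≢⇒∣-∣≡1 a≢b)) ⟩
    ∣ toℕ i - toℕ k ∣ + ∣ toℕ a - toℕ b ∣       ∎)
    where open ≡-Reasoning
  ... | yes refl with step-toward (toℕ i) (toℕ k) (u≢v ∘ λ i≡k → cell-≡ i≡k refl)
  ...   | c , succ , betweenℕ additive = (fromℕ< c<n , a) , inj₁ (refl , succ′) ,
            cong (_+ ∣ toℕ a - toℕ a ∣) (begin
              suc ∣ toℕ (fromℕ< c<n) - toℕ k ∣     ≡⟨ cong (λ x → suc ∣ x - toℕ k ∣) (toℕ-fromℕ< c<n) ⟩
              1 + ∣ c - toℕ k ∣                    ≡⟨ cong (_+ ∣ c - toℕ k ∣) (sym (∣-∣≡1 succ″)) ⟩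
              ∣ toℕ i - c ∣ + ∣ c - toℕ k ∣         ≡⟨ additive ⟩
              ∣ toℕ i - toℕ k ∣                     ∎)
    where
      open ≡-Reasoning
      c<n : c < n
      c<n = Sum.[ (λ (_ , c≤k) → ≤-<-trans c≤k (toℕ<n k))
                , (λ i≡1+c → <-trans (n<1+n c) (subst (_< n) i≡1+c (toℕ<n i))) ] succ
      succ″ : c ≡ suc (toℕ i) ⊎ toℕ i ≡ suc c
      succ″ = Sum.map₁ proj₁ succ
      succ′ : toℕ (fromℕ< c<n) ≡ suc (toℕ i) ⊎ toℕ i ≡ suc (toℕ (fromℕ< c<n))
      succ′ rewrite toℕ-fromℕ< c<n = succ″

  tight-walk : ∀ u v → Σ (List (Cell n)) λ vs → Walk (Grid n) u v vs × len vs ≡ δ u v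
  tight-walk u v = go (δ u v) u refl
    where
      go : ∀ m u → δ u v ≡ m → Σ (List (Cell n)) λ vs → Walk (Grid n) u v vs × len vs ≡ m
      go zero u δ≡0 with δ≡0⇒≡ {u} {v} δ≡0
      ... | refl = u ∷ [] , single u , refl
      go (suc m) u δ≡1+m with closer-neighbour {u} {v} (λ { refl → 0≢1+n (trans (sym (δ-refl u)) δ≡1+m) })
      ... | w , adj , closer with go m w (suc-injective (trans closer δ≡1+m))
      ...   | vs , p , len≡m = u ∷ vs , step adj p , trans (len-∷ u p) (cong suc len≡m)

  δ-via-≤-len : ∀ {u v vs a} → Walk (Grid n) u v vs → a ∈ vs → δ u a + δ a v ≤ len vs
  δ-via-≤-len {u} (single _) (here refl) = ≤-reflexive (cong₂ _+_ (δ-refl u) (δ-refl u))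
  δ-via-≤-len {u} {v} (step {w = w} {vs = vs} adj p) (here refl) = begin
    δ u u + δ u v       ≡⟨ cong (_+ δ u v) (δ-refl u) ⟩
    δ u v               ≤⟨ δ-step v adj ⟩
    suc (δ w v)         ≡⟨ cong (λ x → suc (x + δ w v)) (sym (δ-refl w)) ⟩
    suc (δ w w + δ w v) ≤⟨ s≤s (δ-via-≤-len p (head∈ p)) ⟩
    suc (len vs)        ≡⟨ sym (len-∷ u p) ⟩
    len (u ∷ vs)        ∎
    where open ≤-Reasoning
  δ-via-≤-len {u} {v} {a = a} (step {w = w} {vs = vs} adj p) (there a∈) = begin
    δ u a + δ a v       ≤⟨ +-monoˡ-≤ (δ a v) (δ-step a adj) ⟩
    suc (δ w a + δ a v) ≤⟨ s≤s (δ-via-≤-len p a∈) ⟩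
    suc (len vs)        ≡⟨ sym (len-∷ u p) ⟩
    len (u ∷ vs)        ∎
    where open ≤-Reasoning

  δ≤len : ∀ {u v vs} → Walk (Grid n) u v vs → δ u v ≤ len vs
  δ≤len {u} {v} p = ≤-trans (≤-reflexive (cong (_+ δ u v) (sym (δ-refl u)))) (δ-via-≤-len p (head∈ p))

  walk-order-head : ∀ {u v vs b} → Walk (Grid n) u v vs → b ∈ vs → δ u u + δ u b + δ b v ≤ len vs
  walk-order-head {u} {v} {b = b} p b∈ =
    ≤-trans (≤-reflexive (cong (λ x → x + δ u b + δ b v) (δ-refl u))) (δ-via-≤-len p b∈)

  walk-order : ∀ {u v vs a b} → Walk (Grid n) u v vs → a ∈ vs → b ∈ vs →
               δ u a + δ a b + δ b v ≤ len vs ⊎ δ u b + δ b a + δ a v ≤ len vs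
  walk-order p@(single _) (here refl) b∈ = inj₁ (walk-order-head p b∈)
  walk-order p@(step _ _) (here refl) b∈ = inj₁ (walk-order-head p b∈)
  walk-order p@(step _ _) (there a∈) (here refl) = inj₂ (walk-order-head p (there a∈))
  walk-order {u} {a = a} {b} (step {w = w} {vs = vs} adj p) (there a∈) (there b∈) =
    Sum.map (extend a b) (extend b a) (walk-order p a∈ b∈)
    where
      extend : ∀ a b → δ w a + δ a b + δ b _ ≤ len vs → δ u a + δ a b + δ b _ ≤ len (u ∷ vs)
      extend a b le = ≤-trans (+-monoˡ-≤ _ (+-monoˡ-≤ (δ a b) (δ-step a adj)))
                              (≤-trans (s≤s le) (≤-reflexive (sym (len-∷ u p))))
  walk-order (single _) (there ())

  tight⇒unique : ∀ {u v vs} → Walk (Grid n) u v vs → len vs ≤ δ u v → Unique vs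
  tight⇒unique (single _) _ = [] ∷ []
  tight⇒unique {u} {v} (step {w = w} {vs = vs} adj p) tight = All.tabulate u∉vs ∷ tight⇒unique p tight′
    where
      open ≤-Reasoning
      u∉vs : ∀ {x} → x ∈ vs → u ≢ x
      u∉vs u∈vs refl = <-irrefl refl (begin-strict
        δ u v          ≤⟨ m≤n+m (δ u v) (δ w u) ⟩
        δ w u + δ u v  ≤⟨ δ-via-≤-len p u∈vs ⟩
        len vs         <⟨ n<1+n (len vs) ⟩
        suc (len vs)   ≡⟨ sym (len-∷ u p) ⟩
        len (u ∷ vs)   ≤⟨ tight ⟩
        δ u v          ∎)
      tight′ : len vs ≤ δ w v
      tight′ = s≤s⁻¹ (begin
        suc (len vs)   ≡⟨ sym (len-∷ u p) ⟩
        len (u ∷ vs)   ≤⟨ tight ⟩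
        δ u v          ≤⟨ δ-step v adj ⟩
        suc (δ w v)    ∎)

  tight⇒geodesic : ∀ {u v vs} → Walk (Grid n) u v vs → len vs ≡ δ u v → Geodesic (Grid n) u v vs
  tight⇒geodesic p tight =
    (p , tight⇒unique p (≤-reflexive tight)) , λ _ (q , _) → ≤-trans (≤-reflexive tight) (δ≤len q)

  geodesic-len : ∀ {u v g} → Geodesic (Grid n) u v g → len g ≡ δ u v
  geodesic-len {u} {v} ((p , _) , shortest) with tight-walk u v
  ... | vs , q , tight =
    ≤-antisym (≤-trans (shortest vs (proj₁ (tight⇒geodesic q tight))) (≤-reflexive tight)) (δ≤len p)

  geodesic-chain : ∀ {u v g a b c} → Geodesic (Grid n) u v g →
                   δ u a + δ a b + δ b v ≤ len g → δ u b + δ b c + δ c v ≤ len g →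
                   Between a b c × δ a c ≤ len g
  geodesic-chain {u} {v} {g} {a} {b} {c} geo a≺b b≺c =
    between (≤-antisym ab+bc≤ac (δ-triangle a b c)) , ac≤len
    where
      open ≤-Reasoning
      u-a-b : δ u a + δ a b ≤ δ u b
      u-a-b = +-cancelʳ-≤ (δ b v) _ _ (begin
        δ u a + δ a b + δ b v ≤⟨ a≺b ⟩
        len g                 ≡⟨ geodesic-len geo ⟩
        δ u v                 ≤⟨ δ-triangle u b v ⟩
        δ u b + δ b v         ∎)
      through : δ u a + (δ a b + δ b c) + δ c v ≤ len g
      through = begin
        δ u a + (δ a b + δ b c) + δ c v ≡⟨ cong (_+ δ c v) (sym (+-assoc (δ u a) (δ a b) (δ b c))) ⟩
        δ u a + δ a b + δ b c + δ c v   ≤⟨ +-monoˡ-≤ (δ c v) (+-monoˡ-≤ (δ b c) u-a-b) ⟩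
        δ u b + δ b c + δ c v           ≤⟨ b≺c ⟩
        len g                           ∎
      ab+bc≤ac : δ a b + δ b c ≤ δ a c
      ab+bc≤ac = +-cancelˡ-≤ (δ u a) _ _ (+-cancelʳ-≤ (δ c v) _ _ (begin
        δ u a + (δ a b + δ b c) + δ c v ≤⟨ through ⟩
        len g                           ≡⟨ geodesic-len geo ⟩
        δ u v                           ≤⟨ δ-triangle u c v ⟩
        δ u c + δ c v                   ≤⟨ +-monoˡ-≤ (δ c v) (δ-triangle u a c) ⟩
        δ u a + δ a c + δ c v           ∎))
      ac≤len : δ a c ≤ len g
      ac≤len = begin
        δ a c                           ≤⟨ δ-triangle a b c ⟩
        δ a b + δ b c                   ≤⟨ m≤n+m _ (δ u a) ⟩
        δ u a + (δ a b + δ b c)         ≤⟨ m≤m+n _ (δ c v) ⟩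
        δ u a + (δ a b + δ b c) + δ c v ≤⟨ through ⟩
        len g                           ∎

  -- x ≢ z need not be assumed: it follows from Between x y z and y ≢ x (Between-self).
  Spread : ℕ → List (Cell n) → Set
  Spread d S = ∀ {x y z} → x ∈ S → y ∈ S → z ∈ S → y ≢ x → y ≢ z → Between x y z → d < δ x z

  IsKGenDPos⇒Spread : ∀ {d S} → IsKGenDPos (Grid n) 3 d S → Spread d S
  IsKGenDPos⇒Spread {d} gp {x} {y} {z} x∈S y∈S z∈S y≢x y≢z x-y-z with tight-walk x y | tight-walk y z
  ... | xs , p , len-p | ys , q , len-q with walk-++ p q
  ...   | zs , r , len-r , y∈zs =
    subst (d <_) tight (gp x z zs (tight⇒geodesic r tight)
      (x ∷ y ∷ z ∷ [] , distinct , refl , (x∈S ∷ y∈S ∷ z∈S ∷ []) , (head∈ r ∷ y∈zs ∷ last∈ r ∷ [])))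
    where
      tight : len zs ≡ δ x z
      tight = trans len-r (trans (cong₂ _+_ len-p len-q) (δ-additive x-y-z))
      x≢z : x ≢ z
      x≢z refl = y≢x (Between-self x-y-z)
      distinct : Unique (x ∷ y ∷ z ∷ [])
      distinct = (≢-sym y≢x ∷ x≢z ∷ []) ∷ (y≢z ∷ []) ∷ [] ∷ []

  Spread⇒IsKGenDPos : ∀ {d S} → Spread d S → IsKGenDPos (Grid n) 3 d S
  Spread⇒IsKGenDPos {d} {S} spread u v g geo
    (x ∷ y ∷ z ∷ [] , (x≢y ∷ x≢z ∷ []) ∷ (y≢z ∷ []) ∷ [] ∷ [] , refl ,
     x∈S ∷ y∈S ∷ z∈S ∷ [] , x∈g ∷ y∈g ∷ z∈g ∷ []) =
    sort (order x∈g y∈g) (order y∈g z∈g) (order x∈g z∈g)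
    where
      _≺_ : Cell n → Cell n → Set
      a ≺ b = δ u a + δ a b + δ b v ≤ len g
      order : ∀ {a b} → a ∈ g → b ∈ g → a ≺ b ⊎ b ≺ a
      order = walk-order (proj₁ (proj₁ geo))
      sorted : ∀ {a b c} → a ∈ S → b ∈ S → c ∈ S → b ≢ a → b ≢ c → a ≺ b → b ≺ c → d < len g
      sorted a∈ b∈ c∈ b≢a b≢c a≺b b≺c with geodesic-chain geo a≺b b≺c
      ... | a-b-c , ac≤len = <-≤-trans (spread a∈ b∈ c∈ b≢a b≢c a-b-c) ac≤len
      sort : x ≺ y ⊎ y ≺ x → y ≺ z ⊎ z ≺ y → x ≺ z ⊎ z ≺ x → d < len g
      sort (inj₁ x≺y) (inj₁ y≺z) _          = sorted x∈S y∈S z∈S (≢-sym x≢y) y≢z x≺y y≺z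
      sort (inj₂ y≺x) (inj₂ z≺y) _          = sorted z∈S y∈S x∈S y≢z (≢-sym x≢y) z≺y y≺x
      sort (inj₁ x≺y) (inj₂ z≺y) (inj₁ x≺z) = sorted x∈S z∈S y∈S (≢-sym x≢z) (≢-sym y≢z) x≺z z≺y
      sort (inj₁ x≺y) (inj₂ z≺y) (inj₂ z≺x) = sorted z∈S x∈S y∈S x≢z x≢y z≺x x≺y
      sort (inj₂ y≺x) (inj₁ y≺z) (inj₁ x≺z) = sorted y∈S x∈S z∈S x≢y x≢z y≺x x≺z
      sort (inj₂ y≺x) (inj₁ y≺z) (inj₂ z≺x) = sorted y∈S z∈S x∈S (≢-sym y≢z) (≢-sym x≢z) y≺z z≺x

  -- Upper bounds: counting cells in windows of consecutive columns

  InWindow : ℕ → ℕ → Cell n → Set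
  InWindow lo w p = lo ≤ col p × col p < lo + w

  inWindow? : ∀ lo w p → Dec (InWindow lo w p)
  inWindow? lo w p = lo ≤? col p ×-dec col p <? lo + w

  window : ℕ → ℕ → List (Cell n) → List (Cell n)
  window lo w = filter (inWindow? lo w)

  count : ℕ → ℕ → List (Cell n) → ℕ
  count lo w S = length (window lo w S)

  window⁻ : ∀ {lo w} S {p} → p ∈ window lo w S → p ∈ S × InWindow lo w p
  window⁻ {lo} {w} S = ∈-filter⁻ (inWindow? lo w) {xs = S}

  window-unique : ∀ {lo w S} → Unique S → Unique (window lo w S)
  window-unique {lo} {w} = Unique.filter⁺ (inWindow? lo w)

  count-all : ∀ S → length S ≡ count 0 n S
  count-all S = cong length (sym (filter-all (inWindow? 0 n) {S} (All.tabulate (λ {p} _ → z≤n , toℕ<n (proj₁ p)))))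

  count-∷-in : ∀ {lo w p} S → InWindow lo w p → count lo w (p ∷ S) ≡ suc (count lo w S)
  count-∷-in {lo} {w} _ p∈ = cong length (filter-accept (inWindow? lo w) p∈)

  count-∷-out : ∀ {lo w p} S → ¬ InWindow lo w p → count lo w (p ∷ S) ≡ count lo w S
  count-∷-out {lo} {w} _ p∉ = cong length (filter-reject (inWindow? lo w) p∉)

  count-split : ∀ lo a b S → count lo (a + b) S ≡ count lo a S + count (lo + a) b S
  count-split lo a b [] = refl
  count-split lo a b (p ∷ S) with inWindow? lo a p | inWindow? (lo + a) b p
  ... | yes in-a@(lo≤p , p<lo+a) | _ = begin
    count lo (a + b) (p ∷ S)
      ≡⟨ count-∷-in S (lo≤p , <-≤-trans p<lo+a (+-monoʳ-≤ lo (m≤m+n a b))) ⟩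
    suc (count lo (a + b) S)
      ≡⟨ cong suc (count-split lo a b S) ⟩
    suc (count lo a S) + count (lo + a) b S
      ≡⟨ sym (cong₂ _+_ (count-∷-in S in-a) (count-∷-out S (λ (lo+a≤p , _) → <⇒≱ p<lo+a lo+a≤p))) ⟩
    count lo a (p ∷ S) + count (lo + a) b (p ∷ S)
      ∎
    where open ≡-Reasoning
  ... | no out-a | yes in-b@(lo+a≤p , p<lo+a+b) = begin
    count lo (a + b) (p ∷ S)                    ≡⟨ count-∷-in S (≤-trans (m≤m+n lo a) lo+a≤p ,
                                                                   <-≤-trans p<lo+a+b (≤-reflexive (+-assoc lo a b))) ⟩
    suc (count lo (a + b) S)                    ≡⟨ cong suc (count-split lo a b S) ⟩
    suc (count lo a S + count (lo + a) b S)     ≡⟨ sym (+-suc _ _) ⟩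
    count lo a S + suc (count (lo + a) b S)     ≡⟨ sym (cong₂ _+_ (count-∷-out S out-a) (count-∷-in S in-b)) ⟩
    count lo a (p ∷ S) + count (lo + a) b (p ∷ S) ∎
    where open ≡-Reasoning
  ... | no out-a | no out-b = begin
    count lo (a + b) (p ∷ S)                    ≡⟨ count-∷-out S out-ab ⟩
    count lo (a + b) S                          ≡⟨ count-split lo a b S ⟩
    count lo a S + count (lo + a) b S           ≡⟨ sym (cong₂ _+_ (count-∷-out S out-a) (count-∷-out S out-b)) ⟩
    count lo a (p ∷ S) + count (lo + a) b (p ∷ S) ∎
    where
      open ≡-Reasoning
      out-ab : ¬ InWindow lo (a + b) p
      out-ab (lo≤p , p<lo+a+b) with col p <? lo + a
      ... | yes p<lo+a = out-a (lo≤p , p<lo+a)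
      ... | no p≮lo+a = out-b (≮⇒≥ p≮lo+a , <-≤-trans p<lo+a+b (≤-reflexive (sym (+-assoc lo a b))))

  ∣row-row∣≤1 : ∀ p q → ∣ row p - row q ∣ ≤ 1
  ∣row-row∣≤1 p q =
    ≤-trans (∣m-n∣≤m⊔n (row p) (row q)) (⊔-lub (toℕ≤pred[n] (proj₂ p)) (toℕ≤pred[n] (proj₂ q)))

  δ-window : ∀ {lo w p q} → InWindow lo w p → InWindow lo w q → δ p q ≤ w
  δ-window {p = p} {q} (lo≤p , p<lo+w) (lo≤q , q<lo+w) = begin
    ∣ col p - col q ∣ + ∣ row p - row q ∣ ≤⟨ +-monoʳ-≤ ∣ col p - col q ∣ (∣row-row∣≤1 p q) ⟩
    ∣ col p - col q ∣ + 1                 ≡⟨ +-comm ∣ col p - col q ∣ 1 ⟩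
    suc ∣ col p - col q ∣                 ≤⟨ ∣-∣<width lo≤p p<lo+w lo≤q q<lo+w ⟩
    _                                     ∎
    where open ≤-Reasoning

  same-column : ∀ {x y z : Cell n} → col y ≡ col x → col z ≡ col x → y ≢ x → z ≢ y → z ≡ x
  same-column {x} {y} {z} y|x z|x y≢x z≢y = cell-≡ z|x (cong toℕ z~x)
    where
      z~x = Fin2-pigeonhole (proj₂ y) (proj₂ x) (proj₂ z)
              (λ y~x → y≢x (cell-≡ y|x (cong toℕ y~x)))
              (λ z~y → z≢y (cell-≡ (trans z|x (sym y|x)) (cong toℕ z~y)))

  InWindow-1⇒col≡ : ∀ {lo p} → InWindow lo 1 p → col p ≡ lo
  InWindow-1⇒col≡ {lo} {p} (lo≤p , p<lo+1) = ≤-antisym (s≤s⁻¹ (subst (col p <_) (+-comm lo 1) p<lo+1)) lo≤p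

  count-empty : ∀ lo S → count lo 0 S ≡ 0
  count-empty lo S = cong length (filter-none (inWindow? lo 0) {S} (All.tabulate λ {p} _ → empty {p}))
    where
      empty : ∀ {p} → ¬ InWindow lo 0 p
      empty {p} (lo≤p , p<lo+0) = <⇒≱ (subst (col p <_) (+-identityʳ lo) p<lo+0) lo≤p

  count-column≤2 : ∀ {S} lo → Unique S → count lo 1 S ≤ 2
  count-column≤2 {S} lo U = no-distinct-triple⇒length≤2 (window-unique U) no-triple
    where
      col≡lo : ∀ {p} → p ∈ window lo 1 S → col p ≡ lo
      col≡lo {p} p∈ = InWindow-1⇒col≡ {p = p} (proj₂ (window⁻ S p∈))
      no-triple : ∀ {a b c} → a ∈ window lo 1 S → b ∈ window lo 1 S → c ∈ window lo 1 S →
                  a ≢ b → a ≢ c → b ≢ c → ⊥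
      no-triple a∈ b∈ c∈ a≢b a≢c b≢c =
        a≢c (sym (same-column (trans (col≡lo b∈) (sym (col≡lo a∈))) (trans (col≡lo c∈) (sym (col≡lo a∈)))
                              (≢-sym a≢b) (≢-sym b≢c)))

  BetweenFree : List (Cell n) → Set
  BetweenFree T = ∀ {x y z} → x ∈ T → y ∈ T → z ∈ T → y ≢ x → y ≢ z → ¬ Between x y z

  Spread⇒BetweenFree : ∀ {d S} lo {w} → Spread d S → w ≤ d → BetweenFree (window lo w S)
  Spread⇒BetweenFree {S = S} lo spread w≤d {x} {_} {z} x∈ y∈ z∈ y≢x y≢z x-y-z
    with window⁻ S x∈ | window⁻ S y∈ | window⁻ S z∈
  ... | x∈S , x-in | y∈S , _ | z∈S , z-in =
    <⇒≱ (spread x∈S y∈S z∈S y≢x y≢z x-y-z) (≤-trans (δ-window {p = x} {z} x-in z-in) w≤d)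

  same-row-triple : ∀ {T x y z} → BetweenFree T → x ∈ T → y ∈ T → z ∈ T → x ≢ y → x ≢ z → y ≢ z →
                    proj₂ y ≡ proj₂ x → proj₂ z ≡ proj₂ x → ⊥
  same-row-triple {x = x} {y} {z} free x∈ y∈ z∈ x≢y x≢z y≢z y~x z~x with one-between (col x) (col y) (col z)
  ... | inj₁ y-x-z        = free y∈ x∈ z∈ x≢y x≢z (cols⇒Between y-x-z λ _ → sym y~x)
  ... | inj₂ (inj₁ x-y-z) = free x∈ y∈ z∈ (≢-sym x≢y) y≢z (cols⇒Between x-y-z λ _ → y~x)
  ... | inj₂ (inj₂ x-z-y) = free x∈ z∈ y∈ (≢-sym x≢z) (≢-sym y≢z) (cols⇒Between x-z-y λ _ → z~x)

  other-row-inside : ∀ {T x y z} → BetweenFree T → x ∈ T → y ∈ T → z ∈ T → x ≢ y →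
                     proj₂ y ≡ proj₂ x → proj₂ z ≢ proj₂ x → StrictlyBetween (col x) (col z) (col y)
  other-row-inside {x = x} {y} {z} free x∈ y∈ z∈ x≢y y~x z≁x with inside-or-beyond (col x) (col y) (col z)
  ... | inj₁ inside = inside
  ... | inj₂ (inj₁ z-x-y) = ⊥-elim (free z∈ x∈ y∈ (λ { refl → z≁x refl }) x≢y
                              (cols⇒Between z-x-y λ z~y → ⊥-elim (z≁x (trans z~y y~x))))
  ... | inj₂ (inj₂ z-y-x) = ⊥-elim (free z∈ y∈ x∈ (λ { refl → z≁x y~x }) (≢-sym x≢y)
                              (cols⇒Between z-y-x λ z~x → ⊥-elim (z≁x z~x)))

  two-rows-of-two : ∀ {T a b c e} → BetweenFree T → a ∈ T → b ∈ T → c ∈ T → e ∈ T → a ≢ b → c ≢ e →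
                    proj₂ b ≡ proj₂ a → proj₂ e ≡ proj₂ c → proj₂ c ≢ proj₂ a → ⊥
  two-rows-of-two free a∈ b∈ c∈ e∈ a≢b c≢e b~a e~c c≁a =
    StrictlyBetween-nested (other-row-inside free a∈ b∈ c∈ a≢b b~a c≁a)
                           (other-row-inside free a∈ b∈ e∈ a≢b b~a (λ e~a → c≁a (trans (sym e~c) e~a)))
                           (other-row-inside free c∈ e∈ a∈ c≢e e~c (≢-sym c≁a))

  BetweenFree-≤3 : ∀ {T} → Unique T → BetweenFree T → length T ≤ 3
  BetweenFree-≤3 U free = no-distinct-quadruple⇒length≤3 U no-quadruple
    where
      no-quadruple : ∀ {a b c e} → _ → _ → _ → _ → a ≢ b → a ≢ c → a ≢ e → b ≢ c → b ≢ e → c ≢ e → ⊥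
      no-quadruple {a} {b} {c} {e} a∈ b∈ c∈ e∈ a≢b a≢c a≢e b≢c b≢e c≢e
        with proj₂ b ≟ proj₂ a | proj₂ c ≟ proj₂ a | proj₂ e ≟ proj₂ a
      ... | yes b~a | yes c~a | _       = same-row-triple free a∈ b∈ c∈ a≢b a≢c b≢c b~a c~a
      ... | yes b~a | no _    | yes e~a = same-row-triple free a∈ b∈ e∈ a≢b a≢e b≢e b~a e~a
      ... | yes b~a | no c≁a  | no e≁a  =
        two-rows-of-two free a∈ b∈ c∈ e∈ a≢b c≢e b~a (Fin2-pigeonhole (proj₂ a) (proj₂ c) (proj₂ e) (≢-sym c≁a) e≁a) c≁a
      ... | no b≁a  | yes c~a | yes e~a = same-row-triple free a∈ c∈ e∈ a≢c a≢e c≢e c~a e~a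
      ... | no b≁a  | yes c~a | no e≁a  =
        two-rows-of-two free a∈ c∈ b∈ e∈ a≢c b≢e c~a (Fin2-pigeonhole (proj₂ a) (proj₂ b) (proj₂ e) (≢-sym b≁a) e≁a) b≁a
      ... | no b≁a  | no c≁a  | yes e~a =
        two-rows-of-two free a∈ e∈ b∈ c∈ a≢e b≢c e~a (Fin2-pigeonhole (proj₂ a) (proj₂ b) (proj₂ c) (≢-sym b≁a) c≁a) b≁a
      ... | no b≁a  | no c≁a  | no e≁a  =
        same-row-triple free b∈ c∈ e∈ b≢c b≢e c≢e (Fin2-pigeonhole (proj₂ a) (proj₂ b) (proj₂ c) (≢-sym b≁a) c≁a)
                                                   (Fin2-pigeonhole (proj₂ a) (proj₂ b) (proj₂ e) (≢-sym b≁a) e≁a)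

  count-two-columns≤2 : ∀ {d S} lo → Spread d S → Unique S → 2 ≤ d → count lo 2 S ≤ 2
  count-two-columns≤2 {S = S} lo spread U 2≤d = no-distinct-triple⇒length≤2 (window-unique U) no-triple
    where
      free = Spread⇒BetweenFree lo spread 2≤d
      too-far : ∀ {p q m} → p ∈ window lo 2 S → q ∈ window lo 2 S → ¬ StrictlyBetween (col p) m (col q)
      too-far p∈ q∈ inside with window⁻ S p∈ | window⁻ S q∈
      ... | _ , lo≤p , p<lo+2 | _ , lo≤q , q<lo+2 =
        <⇒≱ (∣-∣<width lo≤p p<lo+2 lo≤q q<lo+2) (StrictlyBetween⇒2≤∣-∣ inside)
      no-triple : ∀ {a b c} → a ∈ window lo 2 S → b ∈ window lo 2 S → c ∈ window lo 2 S →
                  a ≢ b → a ≢ c → b ≢ c → ⊥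
      no-triple {a} {b} {c} a∈ b∈ c∈ a≢b a≢c b≢c with proj₂ b ≟ proj₂ a | proj₂ c ≟ proj₂ a
      ... | yes b~a | yes c~a = same-row-triple free a∈ b∈ c∈ a≢b a≢c b≢c b~a c~a
      ... | yes b~a | no c≁a  = too-far a∈ b∈ (other-row-inside free a∈ b∈ c∈ a≢b b~a c≁a)
      ... | no b≁a  | yes c~a = too-far a∈ c∈ (other-row-inside free a∈ c∈ b∈ a≢c c~a b≁a)
      ... | no b≁a  | no c≁a  =
        too-far b∈ c∈ (other-row-inside free b∈ c∈ a∈ b≢c (Fin2-pigeonhole (proj₂ a) (proj₂ b) (proj₂ c) (≢-sym b≁a) c≁a)
                                        (≢-sym b≁a))

  count≤⊓3 : ∀ {d S} lo {w} → Spread d S → Unique S → 2 ≤ w → w ≤ d → count lo w S ≤ w ⊓ 3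
  count≤⊓3 lo {2} spread U _ 2≤d = count-two-columns≤2 lo spread U 2≤d
  count≤⊓3 lo {1} _ _ (s≤s ()) _
  count≤⊓3 {S = S} lo {w@(suc (suc (suc _)))} spread U _ w≤d =
    subst (count lo w S ≤_) (sym (m≥n⇒m⊓n≡n {w} (s≤s (s≤s (s≤s z≤n)))))
          (BetweenFree-≤3 (window-unique U) (Spread⇒BetweenFree lo spread w≤d))

  count-blocks : ∀ {w k} S → (∀ lo → count lo w S ≤ k) → ∀ q lo → count lo (q * w) S ≤ q * k
  count-blocks S block zero lo = ≤-reflexive (count-empty lo S)
  count-blocks {w} {k} S block (suc q) lo = begin
    count lo (w + q * w) S                ≡⟨ count-split lo w (q * w) S ⟩
    count lo w S + count (lo + w) (q * w) S ≤⟨ +-mono-≤ (block lo) (count-blocks S block q (lo + w)) ⟩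
    k + q * k                             ∎
    where open ≤-Reasoning

  column-pair-blocks′ : ∀ {d S x y c} → Spread d S → x ∈ S → y ∈ S → c ∈ S →
                        col y ≡ col x → proj₂ y ≢ proj₂ x → proj₂ c ≡ proj₂ y → col x < col c → col c < col x + d → ⊥
  column-pair-blocks′ {x = x} {y} {c} spread x∈ y∈ c∈ y|x y≁x c~y x<c c<x+d =
    <⇒≱ (spread x∈ y∈ c∈ y≢x y≢c x-y-c) (δ-window {p = x} {c} (≤-refl , <-trans x<c c<x+d) (<⇒≤ x<c , c<x+d))
    where
      y≢x : y ≢ x
      y≢x y≡x = y≁x (cong proj₂ y≡x)
      y≢c : y ≢ c
      y≢c y≡c = <⇒≢ x<c (trans (sym y|x) (cong col y≡c))
      x-y-c : Between x y c
      x-y-c = cols⇒Between (≤⇒Betweenℕ (≤-reflexive (sym y|x)) (≤-trans (≤-reflexive y|x) (<⇒≤ x<c)))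
                           (λ x~c → sym (trans x~c c~y))

  column-pair-blocks : ∀ {d S a b c} → Spread d S → a ∈ S → b ∈ S → c ∈ S → a ≢ b → col b ≡ col a →
                       col a < col c → col c < col a + d → ⊥
  column-pair-blocks {d} {a = a} {b} {c} spread a∈ b∈ c∈ a≢b b|a a<c c<a+d with proj₂ c ≟ proj₂ b
  ... | yes c~b = column-pair-blocks′ spread a∈ b∈ c∈ b|a b≁a c~b a<c c<a+d
    where b≁a = λ b~a → a≢b (sym (cell-≡ b|a (cong toℕ b~a)))
  ... | no c≁b = column-pair-blocks′ spread b∈ a∈ c∈ (sym b|a) (≢-sym b≁a) c~a
                   (subst (_< col c) (sym b|a) a<c) (subst (λ x → col c < x + d) (sym b|a) c<a+d)
    where
      b≁a = λ b~a → a≢b (sym (cell-≡ b|a (cong toℕ b~a)))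
      c~a = Fin2-pigeonhole (proj₂ b) (proj₂ a) (proj₂ c) b≁a c≁b

  count-block≤3 : ∀ {d S} lo → Spread d S → Unique S → count lo d S ≤ 3
  count-block≤3 lo spread U = BetweenFree-≤3 (window-unique U) (Spread⇒BetweenFree lo spread ≤-refl)

  -- Two cells in the first column leave the next d - 1 columns empty (column-pair-blocks).
  count-wide≤4 : ∀ {d S} lo → Spread d S → Unique S → 1 ≤ d → count lo (suc d) S ≤ 4
  count-wide≤4 {d} {S} lo spread U 1≤d with count lo 1 S ≤? 1
  ... | yes first≤1 = begin
    count lo (1 + d) S                ≡⟨ count-split lo 1 d S ⟩
    count lo 1 S + count (lo + 1) d S ≤⟨ +-mono-≤ first≤1 (count-block≤3 (lo + 1) spread U) ⟩
    4                                 ∎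
    where open ≤-Reasoning
  ... | no first≰1 with two-distinct-members (window-unique {lo} {1} U) (≰⇒> first≰1)
  ...   | a , b , a∈ , b∈ , a≢b = begin
    count lo (1 + d) S                                               ≡⟨ count-split lo 1 d S ⟩
    count lo 1 S + count (lo + 1) d S
      ≡⟨ cong (λ w → count lo 1 S + count (lo + 1) w S) (sym (m∸n+n≡m 1≤d)) ⟩
    count lo 1 S + count (lo + 1) (d ∸ 1 + 1) S
      ≡⟨ cong (count lo 1 S +_) (count-split (lo + 1) (d ∸ 1) 1 S) ⟩
    count lo 1 S + (count (lo + 1) (d ∸ 1) S + count (lo + 1 + (d ∸ 1)) 1 S)
      ≤⟨ +-mono-≤ (count-column≤2 lo U) (+-mono-≤ middle-empty (count-column≤2 _ U)) ⟩
    4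
      ∎
    where
      open ≤-Reasoning
      middle-empty : count (lo + 1) (d ∸ 1) S ≤ 0
      middle-empty = ≮⇒≥ λ 0<middle → let (c , c∈) = member-of-nonempty 0<middle in blocked c∈
        where
          blocked : ∀ {c} → c ∈ window (lo + 1) (d ∸ 1) S → ⊥
          blocked {c} c∈ with window⁻ S a∈ | window⁻ S b∈ | window⁻ S c∈
          ... | a∈S , a-in | b∈S , b-in | c∈S , lo+1≤c , c<end =
            column-pair-blocks spread a∈S b∈S c∈S a≢b (trans b|lo (sym a|lo))
              (subst (_< col c) (sym a|lo) (subst (_≤ col c) (+-comm lo 1) lo+1≤c))
              (subst (col c <_) (trans (+-assoc lo 1 (d ∸ 1))
                                       (trans (cong (lo +_) (m+[n∸m]≡n 1≤d)) (cong (_+ d) (sym a|lo)))) c<end)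
            where
              a|lo = InWindow-1⇒col≡ {p = a} a-in
              b|lo = InWindow-1⇒col≡ {p = b} b-in

  length≡blocks+rest : ∀ {w} S q r → r + q * w ≡ n → length S ≡ count 0 (q * w) S + count (q * w) r S
  length≡blocks+rest {w} S q r n≡ = begin
    length S                              ≡⟨ count-all S ⟩
    count 0 n S                           ≡⟨ cong (λ m → count 0 m S) (trans (sym n≡) (+-comm r (q * w))) ⟩
    count 0 (q * w + r) S                 ≡⟨ count-split 0 (q * w) r S ⟩
    count 0 (q * w) S + count (q * w) r S ∎
    where open ≡-Reasoning

  length≤-n≤d : ∀ {d S} → Spread d S → Unique S → 2 ≤ n → n ≤ d → length S ≤ n ⊓ 3
  length≤-n≤d {S = S} spread U 2≤n n≤d = subst (_≤ n ⊓ 3) (sym (count-all S)) (count≤⊓3 0 spread U 2≤n n≤d)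

  length≤-d≡2 : ∀ {S} → Spread 2 S → Unique S → ∀ q r → r < 2 → r + q * 2 ≡ n →
                length S ≤ 2 * q + 2 * (r ⊓ 1)
  length≤-d≡2 {S} spread U q r r<2 n≡ = begin
    length S                              ≡⟨ length≡blocks+rest S q r n≡ ⟩
    count 0 (q * 2) S + count (q * 2) r S ≤⟨ +-mono-≤ (count-blocks S (λ lo → count-two-columns≤2 lo spread U ≤-refl) q 0)
                                                     (rest r r<2) ⟩
    q * 2 + 2 * (r ⊓ 1)                   ≡⟨ cong (_+ 2 * (r ⊓ 1)) (*-comm q 2) ⟩
    2 * q + 2 * (r ⊓ 1)                   ∎
    where
      open ≤-Reasoning
      rest : ∀ r → r < 2 → count (q * 2) r S ≤ 2 * (r ⊓ 1)
      rest 0 _ = ≤-reflexive (count-empty (q * 2) S)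
      rest 1 _ = count-column≤2 (q * 2) U
      rest (suc (suc _)) (s≤s (s≤s ()))

  length≤-d≥3 : ∀ {d S} → Spread d S → Unique S → 3 ≤ d → d < n → ∀ q r → r < d → r + q * d ≡ n →
                length S ≤ 3 * q + r ⊓ 3
  length≤-d≥3 {d} {S} spread U 3≤d d<n q 0 _ n≡ = begin
    length S                              ≡⟨ length≡blocks+rest S q 0 n≡ ⟩
    count 0 (q * d) S + count (q * d) 0 S ≤⟨ +-mono-≤ (count-blocks S (λ lo → count-block≤3 lo spread U) q 0)
                                                     (≤-reflexive (count-empty (q * d) S)) ⟩
    q * 3 + 0                             ≡⟨ cong (_+ 0) (*-comm q 3) ⟩
    3 * q + 0                             ∎
    where open ≤-Reasoning
  length≤-d≥3 {d} _ _ 3≤d d<n 0 1 _ n≡ = ⊥-elim (<⇒≱ (subst (d <_) (sym n≡) d<n) (≤-trans (s≤s z≤n) 3≤d))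
  length≤-d≥3 {d} {S} spread U 3≤d d<n (suc q) 1 _ n≡ = begin
    length S                                  ≡⟨ length≡blocks+rest S q (suc d) n≡ ⟩
    count 0 (q * d) S + count (q * d) (suc d) S ≤⟨ +-mono-≤ (count-blocks S (λ lo → count-block≤3 lo spread U) q 0)
                                                         (count-wide≤4 (q * d) spread U (≤-trans (s≤s z≤n) 3≤d)) ⟩
    q * 3 + 4                                 ≡⟨ rearrange q ⟩
    3 * suc q + 1                             ∎
    where
      open ≤-Reasoning
      rearrange : ∀ q → q * 3 + 4 ≡ 3 * suc q + 1
      rearrange = solve-∀
  length≤-d≥3 {d} {S} spread U 3≤d d<n q r@(suc (suc _)) r<d n≡ = begin
    length S                              ≡⟨ length≡blocks+rest S q r n≡ ⟩
    count 0 (q * d) S + count (q * d) r S ≤⟨ +-mono-≤ (count-blocks S (λ lo → count-block≤3 lo spread U) q 0)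
                                                     (count≤⊓3 (q * d) spread U (s≤s (s≤s z≤n)) (<⇒≤ r<d)) ⟩
    q * 3 + r ⊓ 3                         ≡⟨ cong (_+ r ⊓ 3) (*-comm q 3) ⟩
    3 * q + r ⊓ 3                         ∎
    where open ≤-Reasoning

-- Extremal sets

alternate : ℕ → Fin 2
alternate zero = zero
alternate (suc zero) = suc zero
alternate (suc (suc t)) = alternate t

alternate-suc : ∀ t → alternate (suc t) ≢ alternate t
alternate-suc zero ()
alternate-suc (suc zero) ()
alternate-suc (suc (suc t)) = alternate-suc t

⌊/2⌋-alternate-injective : ∀ {t t′} → ⌊ t /2⌋ ≡ ⌊ t′ /2⌋ → alternate t ≡ alternate t′ → t ≡ t′
⌊/2⌋-alternate-injective {zero} {zero} _ _ = refl
⌊/2⌋-alternate-injective {zero} {suc zero} _ ()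
⌊/2⌋-alternate-injective {suc zero} {zero} _ ()
⌊/2⌋-alternate-injective {suc zero} {suc zero} _ _ = refl
⌊/2⌋-alternate-injective {suc (suc t)} {suc (suc t′)} half≡ alt≡ =
  cong (2 +_) (⌊/2⌋-alternate-injective (suc-injective half≡) alt≡)

⌊/2⌋<  : ∀ {t k} → t < 2 * k → ⌊ t /2⌋ < k
⌊/2⌋< {zero} {suc _} _ = s≤s z≤n
⌊/2⌋< {suc zero} {suc _} _ = s≤s z≤n
⌊/2⌋< {suc (suc t)} {suc k} t+2<2k+2 =
  s≤s (⌊/2⌋< (s≤s⁻¹ (s≤s⁻¹ (subst (suc (suc t) <_) (*-suc 2 k) t+2<2k+2))))

-- The t-th cell of the extremal set for d = D ≥ 3 is (zigzag D t , alternate t).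
zigzag : ℕ → ℕ → ℕ
zigzag D zero = 0
zigzag D (suc zero) = 1
zigzag D (suc (suc zero)) = 2
zigzag D (suc (suc (suc t))) = D + zigzag D t

zigzag-small : ∀ {D t} → t < 3 → zigzag D t ≡ t
zigzag-small {t = zero} _ = refl
zigzag-small {t = suc zero} _ = refl
zigzag-small {t = suc (suc zero)} _ = refl
zigzag-small {t = suc (suc (suc _))} (s≤s (s≤s (s≤s ())))

module _ {D : ℕ} (3≤D : 3 ≤ D) where

  zigzag-<-suc : ∀ t → zigzag D t < zigzag D (suc t)
  zigzag-<-suc zero = s≤s z≤n
  zigzag-<-suc (suc zero) = s≤s (s≤s z≤n)
  zigzag-<-suc (suc (suc zero)) = subst (2 <_) (sym (+-identityʳ D)) 3≤D
  zigzag-<-suc (suc (suc (suc t))) = +-monoʳ-< D (zigzag-<-suc t)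

  zigzag-mono-< : ∀ {t t′} → t < t′ → zigzag D t < zigzag D t′
  zigzag-mono-< {t} {suc t′} t<1+t′ with m≤n⇒m<n∨m≡n (s≤s⁻¹ t<1+t′)
  ... | inj₁ t<t′ = <-trans (zigzag-mono-< t<t′) (zigzag-<-suc t′)
  ... | inj₂ refl = zigzag-<-suc t

  zigzag-reflects-≤ : ∀ {t t′} → zigzag D t ≤ zigzag D t′ → t ≤ t′
  zigzag-reflects-≤ z≤z′ = ≮⇒≥ λ t′<t → <⇒≱ (zigzag-mono-< t′<t) z≤z′

  zigzag-injective : ∀ {t t′} → zigzag D t ≡ zigzag D t′ → t ≡ t′
  zigzag-injective z≡z′ =
    ≤-antisym (zigzag-reflects-≤ (≤-reflexive z≡z′)) (zigzag-reflects-≤ (≤-reflexive (sym z≡z′)))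

  first-block : ∀ q r {t} → t < 3 → zigzag D t < suc q * D + r
  first-block q r t<3 =
    subst (_< D + q * D + r) (sym (zigzag-small {D} t<3))
          (<-≤-trans t<3 (≤-trans 3≤D (≤-trans (m≤m+n D (q * D)) (m≤m+n _ r))))

  zigzag-bound : ∀ q r {t} → t < q * 3 + r ⊓ 3 → zigzag D t < q * D + r
  zigzag-bound zero r t<r⊓3 =
    subst (_< r) (sym (zigzag-small {D} (<-≤-trans t<r⊓3 (m⊓n≤n r 3)))) (<-≤-trans t<r⊓3 (m⊓n≤m r 3))
  zigzag-bound (suc q) r {suc (suc (suc t))} (s≤s (s≤s (s≤s t<))) =
    subst (D + zigzag D t <_) (sym (+-assoc D (q * D) r)) (+-monoʳ-< D (zigzag-bound q r t<))
  zigzag-bound (suc q) r {0} _ = first-block q r (s≤s z≤n)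
  zigzag-bound (suc q) r {1} _ = first-block q r (s≤s (s≤s z≤n))
  zigzag-bound (suc q) r {2} _ = first-block q r ≤-refl

  zigzag-far-apart : ∀ {t t′} → 3 + t ≤ t′ →
                     D < ∣ zigzag D t - zigzag D t′ ∣ + ∣ toℕ (alternate t) - toℕ (alternate t′) ∣
  zigzag-far-apart {t} {t′} 3+t≤t′ with m≤n⇒m<n∨m≡n 3+t≤t′
  ... | inj₂ refl = ≤-reflexive (begin
    suc D                                                             ≡⟨ +-comm 1 D ⟩
    D + 1                                                             ≡⟨ cong₂ _+_ (sym gap) (sym (Fin2-≢⇒∣-∣≡1 (≢-sym (alternate-suc t)))) ⟩
    ∣ z - D + z ∣ + ∣ toℕ (alternate t) - toℕ (alternate (suc t)) ∣ ∎)
    where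
      open ≡-Reasoning
      z = zigzag D t
      gap : ∣ z - D + z ∣ ≡ D
      gap = trans (cong (∣ z -_∣) (+-comm D z)) (∣m-m+n∣≡n z D)
  ... | inj₁ 3+t<t′ = begin-strict
    D                           ≡⟨ sym (m+n∸n≡m D z) ⟩
    D + z ∸ z                   <⟨ ∸-monoˡ-< (zigzag-mono-< 3+t<t′) (m≤n+m z D) ⟩
    z′ ∸ z                      ≤⟨ m∸n≤∣m-n∣ z′ z ⟩
    ∣ z′ - z ∣                  ≡⟨ ∣-∣-comm z′ z ⟩
    ∣ z - z′ ∣                  ≤⟨ m≤m+n _ _ ⟩
    ∣ z - z′ ∣ + ∣ toℕ (alternate t) - toℕ (alternate t′) ∣ ∎
    where
      open ≤-Reasoning
      z = zigzag D t
      z′ = zigzag D t′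

module _ {n : ℕ} where

  record At (c : ℕ → ℕ) (r : ℕ → Fin 2) (t : ℕ) (p : Cell n) : Set where
    constructor at
    field
      col≡ : col p ≡ c t
      row≡ : proj₂ p ≡ r t

  At-unique : ∀ {c r t p q} → At c r t p → At c r t q → p ≡ q
  At-unique (at p| p~) (at q| q~) = cell-≡ (trans p| (sym q|)) (cong toℕ (trans p~ (sym q~)))

  Fits : ℕ → (ℕ → ℕ) → Set
  Fits m c = ∀ {t} → t < m → c t < n

  cells : ∀ m (c : ℕ → ℕ) (r : ℕ → Fin 2) → Fits m c → List (Cell n)
  cells m c r c<n = tabulate {n = m} λ t → fromℕ< (c<n (toℕ<n t)) , r (toℕ t)

  length-cells : ∀ m c r (c<n : Fits m c) → length (cells m c r c<n) ≡ m
  length-cells m c r c<n = length-tabulate {n = m} _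

  cells⁻ : ∀ m c r (c<n : Fits m c) {p} → p ∈ cells m c r c<n → ∃ λ t → At c r t p
  cells⁻ m c r c<n p∈ with ∈-tabulate⁻ p∈
  ... | t , refl = toℕ t , at (toℕ-fromℕ< (c<n (toℕ<n t))) refl

  cells-unique : ∀ m c r (c<n : Fits m c) → (∀ {t t′} → c t ≡ c t′ → r t ≡ r t′ → t ≡ t′) →
                 Unique (cells m c r c<n)
  cells-unique m c r c<n injective = Unique.tabulate⁺ λ {i} {j} cell≡ →
    toℕ-injective (injective (begin
      c (toℕ i)                          ≡⟨ sym (toℕ-fromℕ< (c<n (toℕ<n i))) ⟩
      toℕ (fromℕ< (c<n (toℕ<n i)))       ≡⟨ cong (toℕ ∘ proj₁) cell≡ ⟩
      toℕ (fromℕ< (c<n (toℕ<n j)))       ≡⟨ toℕ-fromℕ< (c<n (toℕ<n j)) ⟩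
      c (toℕ j)                          ∎) (cong proj₂ cell≡))
    where open ≡-Reasoning

  pair-spread : ∀ {d} (p q : Cell n) → Spread d (p ∷ q ∷ [])
  pair-spread p q {x} {y} x∈ y∈ z∈ y≢x y≢z x-y-z =
    ⊥-elim (y≢x (Between-self (subst (Between x y) (sym (ends x∈ y∈ z∈ y≢x y≢z)) x-y-z)))
    where
      ends : ∀ {x y z} → x ∈ p ∷ q ∷ [] → y ∈ p ∷ q ∷ [] → z ∈ p ∷ q ∷ [] → y ≢ x → y ≢ z → x ≡ z
      ends (here refl)         _                   (here refl)         _   _   = refl
      ends (there (here refl)) _                   (there (here refl)) _   _   = refl
      ends (here refl)         (here refl)         _                   y≢x _   = ⊥-elim (y≢x refl)
      ends (there (here refl)) (there (here refl)) _                   y≢x _   = ⊥-elim (y≢x refl)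
      ends (here refl)         (there (here refl)) (there (here refl)) _   y≢z = ⊥-elim (y≢z refl)
      ends (there (here refl)) (here refl)         (here refl)         _   y≢z = ⊥-elim (y≢z refl)

  close-even-columns : ∀ {p q : Cell n} → ∃ (λ a → col p ≡ 2 * a) → ∃ (λ b → col q ≡ 2 * b) → δ p q ≤ 1 →
                       col q ≡ col p
  close-even-columns {p} {q} (a , p|2a) (b , q|2b) δ≤1 = trans q|2b (trans (cong (2 *_) (sym a≡b)) (sym p|2a))
    where
      2∣a-b∣≤1 : 2 * ∣ a - b ∣ ≤ 1
      2∣a-b∣≤1 = begin
        2 * ∣ a - b ∣          ≡⟨ *-distribˡ-∣-∣ 2 a b ⟩
        ∣ 2 * a - 2 * b ∣      ≡⟨ sym (cong₂ ∣_-_∣ p|2a q|2b) ⟩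
        ∣ col p - col q ∣      ≤⟨ m≤m+n _ _ ⟩
        δ p q                  ≤⟨ δ≤1 ⟩
        1                      ∎
        where open ≤-Reasoning
      a≡b : a ≡ b
      a≡b = ∣m-n∣≡0⇒m≡n (n≤0⇒n≡0 (≮⇒≥ λ 0<∣a-b∣ → <⇒≱ ≤-refl (≤-trans (*-monoʳ-≤ 2 0<∣a-b∣) 2∣a-b∣≤1)))

  even-columns-spread : ∀ {S} → (∀ {p} → p ∈ S → ∃ λ k → col p ≡ 2 * k) → Spread 2 S
  even-columns-spread even {x} {y} {z} x∈ y∈ z∈ y≢x y≢z x-y-z = ≰⇒> λ δxz≤2 →
    let δxy≤1 = +-cancelʳ-≤ 1 (δ x y) 1 (≤-trans (+-monoʳ-≤ (δ x y) (≢⇒1≤δ y≢z))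
                                                 (≤-trans (≤-reflexive (δ-additive x-y-z)) δxz≤2))
        δyz≤1 = +-cancelˡ-≤ 1 (δ y z) 1 (≤-trans (+-monoˡ-≤ (δ y z) (≢⇒1≤δ (≢-sym y≢x)))
                                                 (≤-trans (≤-reflexive (δ-additive x-y-z)) δxz≤2))
        y|x = close-even-columns {x} {y} (even x∈) (even y∈) δxy≤1
        z|y = close-even-columns {y} {z} (even y∈) (even z∈) δyz≤1
        z≡x = same-column y|x (trans z|y y|x) y≢x (≢-sym y≢z)
    in y≢x (Between-self (subst (Between x y) z≡x x-y-z))

  zigzag-between-indices : ∀ {D x y z tx ty tz} → 3 ≤ D →
                           At (zigzag D) alternate tx x → At (zigzag D) alternate ty y → At (zigzag D) alternate tz z →
                           y ≢ x → y ≢ z → Between x y z → zigzag D tx ≤ zigzag D tz → tx < ty × ty < tz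
  zigzag-between-indices 3≤D x-at@(at x| _) y-at@(at y| _) z-at@(at z| _) y≢x y≢z x-y-z zx≤zz
    with Betweenℕ⇒≤ (Betweenℕ-cong x| y| z| (proj₁ (Between⇒Betweenℕ x-y-z))) zx≤zz
  ... | zx≤zy , zy≤zz = ≤∧≢⇒< (zigzag-reflects-≤ 3≤D zx≤zy) (λ { refl → y≢x (At-unique y-at x-at) }) ,
                        ≤∧≢⇒< (zigzag-reflects-≤ 3≤D zy≤zz) (λ { refl → y≢z (At-unique y-at z-at) })

  zigzag-ordered : ∀ {D x y z tx ty tz} → 3 ≤ D →
                   At (zigzag D) alternate tx x → At (zigzag D) alternate ty y → At (zigzag D) alternate tz z →
                   y ≢ x → y ≢ z → Between x y z → zigzag D tx ≤ zigzag D tz → D < δ x z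
  zigzag-ordered {D} {x} {_} {z} {tx} {ty} {tz} 3≤D x-at@(at x| x~) y-at@(at _ y~) z-at@(at z| z~)
                 y≢x y≢z x-y-z zx≤zz
    with zigzag-between-indices 3≤D x-at y-at z-at y≢x y≢z x-y-z zx≤zz
  ... | tx<ty , ty<tz with m≤n⇒m<n∨m≡n (≤-trans (s≤s tx<ty) ty<tz)
  ...   | inj₁ 3+tx≤tz = subst (D <_) (sym δ-indices) (zigzag-far-apart 3≤D 3+tx≤tz)
    where
      δ-indices : δ x z ≡ ∣ zigzag D tx - zigzag D tz ∣ + ∣ toℕ (alternate tx) - toℕ (alternate tz) ∣
      δ-indices = cong₂ _+_ (cong₂ ∣_-_∣ x| z|) (cong₂ ∣_-_∣ (cong toℕ x~) (cong toℕ z~))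
  ...   | inj₂ refl = ⊥-elim (alternate-suc tx (subst (λ t → alternate t ≡ alternate tx) ty≡1+tx rows))
    where
      rows : alternate ty ≡ alternate tx
      rows = trans (sym y~) (trans (Between⇒row-≡ x-y-z (trans x~ (sym z~))) x~)
      ty≡1+tx : ty ≡ suc tx
      ty≡1+tx = ≤-antisym (s≤s⁻¹ ty<tz) tx<ty

  zigzag-spread : ∀ {D m} → 3 ≤ D → (c<n : Fits m (zigzag D)) → Spread D (cells m (zigzag D) alternate c<n)
  zigzag-spread {D} {m} 3≤D c<n {x} {_} {z} x∈ y∈ z∈ y≢x y≢z x-y-z
    with cells⁻ m (zigzag D) alternate c<n x∈ | cells⁻ m (zigzag D) alternate c<n y∈
       | cells⁻ m (zigzag D) alternate c<n z∈
  ... | tx , x-at | ty , y-at | tz , z-at with ≤-total (zigzag D tx) (zigzag D tz)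
  ...   | inj₁ zx≤zz = zigzag-ordered 3≤D x-at y-at z-at y≢x y≢z x-y-z zx≤zz
  ...   | inj₂ zz≤zx = subst (D <_) (δ-sym z x) (zigzag-ordered 3≤D z-at y-at x-at y≢z y≢x (Between-sym x-y-z) zz≤zx)

  isGp : ∀ {d m} S → Unique S → Spread d S → length S ≡ m →
         (∀ {T} → Unique T → Spread d T → length T ≤ m) → IsGp 3 d (Grid n) m
  isGp S U spread length≡m bound =
    (S , U , Spread⇒IsKGenDPos spread , length≡m) , λ T UT gpT → bound UT (IsKGenDPos⇒Spread gpT)

  zigzag-isGp : ∀ {d} → 3 ≤ d → ∀ m → Fits m (zigzag d) →
                (∀ {T} → Unique T → Spread d T → length T ≤ m) → IsGp 3 d (Grid n) m
  zigzag-isGp {d} 3≤d m fit =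
    isGp (cells m (zigzag d) alternate fit)
         (cells-unique m (zigzag d) alternate fit λ z≡z′ _ → zigzag-injective 3≤d z≡z′)
         (zigzag-spread 3≤d fit) (length-cells m (zigzag d) alternate fit)

  evens-fit : ∀ {k} → 2 * k ≤ suc n → Fits (2 * k) (λ t → 2 * ⌊ t /2⌋)
  evens-fit {k} 2k≤1+n {t} t<2k = s≤s⁻¹ (begin
    suc (suc (2 * ⌊ t /2⌋)) ≡⟨ sym (*-suc 2 ⌊ t /2⌋) ⟩
    2 * suc ⌊ t /2⌋         ≤⟨ *-monoʳ-≤ 2 (⌊/2⌋< {t} {k} t<2k) ⟩
    2 * k                   ≤⟨ 2k≤1+n ⟩
    suc n                   ∎)
    where open ≤-Reasoning

  evens-isGp : ∀ k → 2 * k ≤ suc n → (∀ {T} → Unique T → Spread 2 T → length T ≤ 2 * k) →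
               IsGp 3 2 (Grid n) (2 * k)
  evens-isGp k 2k≤1+n =
    isGp (cells (2 * k) c alternate fit) (cells-unique (2 * k) c alternate fit injective)
         (even-columns-spread even) (length-cells (2 * k) c alternate fit)
    where
      c : ℕ → ℕ
      c t = 2 * ⌊ t /2⌋
      fit : Fits (2 * k) c
      fit = evens-fit {k} 2k≤1+n
      injective : ∀ {t t′} → c t ≡ c t′ → alternate t ≡ alternate t′ → t ≡ t′
      injective c≡c′ = ⌊/2⌋-alternate-injective (*-cancelˡ-≡ _ _ 2 c≡c′)
      even : ∀ {p} → p ∈ cells (2 * k) c alternate fit → ∃ λ j → col p ≡ 2 * j
      even p∈ with cells⁻ (2 * k) c alternate fit p∈
      ... | t , at p| _ = ⌊ t /2⌋ , p|

first-column-isGp : ∀ {d n} → (∀ {T} → Unique T → Spread d T → length T ≤ 2) → IsGp 3 d (Grid (suc n)) 2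
first-column-isGp = isGp ((zero , zero) ∷ (zero , suc zero) ∷ []) (((λ ()) ∷ []) ∷ [] ∷ []) (pair-spread _ _) refl

gp-n≡1 : ∀ d → IsGp 3 d (Grid 1) 2
gp-n≡1 d = first-column-isGp λ {T} U _ → subst (_≤ 2) (sym (count-all T)) (count-column≤2 0 U)

gp-n≤d : ∀ d n → 2 ≤ n → n ≤ d → IsGp 3 d (Grid n) (n ⊓ 3)
gp-n≤d d 2 _ 2≤d = first-column-isGp λ U spread → length≤-n≤d spread U ≤-refl 2≤d
gp-n≤d d 1 (s≤s ()) _
gp-n≤d d n@(suc (suc (suc _))) 2≤n n≤d = zigzag-isGp 3≤d (n ⊓ 3) (zigzag-bound 3≤d 0 n)
  λ U spread → length≤-n≤d spread U 2≤n n≤d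
  where 3≤d = ≤-trans (s≤s (s≤s (s≤s z≤n))) n≤d

gp-d≡2 : ∀ n → IsGp 3 2 (Grid n) (2 * (n / 2) + 2 * ((n % 2) ⊓ 1))
gp-d≡2 n = subst (IsGp 3 2 (Grid n)) (*-distribˡ-+ 2 q (r ⊓ 1))
  (evens-isGp (q + r ⊓ 1) (subst (λ m → 2 * (q + r ⊓ 1) ≤ suc m) n≡ (evens≤ r (m%n<n n 2)))
    λ {T} U spread → subst (length T ≤_) (sym (*-distribˡ-+ 2 q (r ⊓ 1))) (length≤-d≡2 spread U q r (m%n<n n 2) n≡))
  where
    q = n / 2
    r = n % 2
    n≡ : r + q * 2 ≡ n
    n≡ = sym (m≡m%n+[m/n]*n n 2)
    evens≤ : ∀ r → r < 2 → 2 * (q + r ⊓ 1) ≤ suc (r + q * 2)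
    evens≤ 0 _ = ≤-trans (≤-reflexive (trans (cong (2 *_) (+-identityʳ q)) (*-comm 2 q))) (n≤1+n _)
    evens≤ (suc (suc _)) (s≤s (s≤s ()))
    evens≤ 1 _ = ≤-reflexive (trans (*-distribˡ-+ 2 q 1) (trans (+-comm (2 * q) 2) (cong (2 +_) (*-comm 2 q))))

gp-d≥3 : ∀ d n .{{_ : NonZero d}} → 3 ≤ d → d < n → IsGp 3 d (Grid n) (3 * (n / d) + (n % d) ⊓ 3)
gp-d≥3 d n 3≤d d<n = zigzag-isGp 3≤d _ fit λ U spread → length≤-d≥3 spread U 3≤d d<n q r (m%n<n n d) n≡
  where
    q = n / d
    r = n % d
    n≡ : r + q * d ≡ n
    n≡ = sym (m≡m%n+[m/n]*n n d)
    fit : Fits (3 * q + r ⊓ 3) (zigzag d)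
    fit {t} t< = subst (zigzag d t <_) (trans (+-comm (q * d) r) n≡)
                   (zigzag-bound 3≤d q r (subst (t <_) (cong (_+ r ⊓ 3) (*-comm 3 q)) t<))

theorem6p4 : (d n : ℕ) → .{{_ : NonZero d}} → 1 ≤ d → 1 ≤ n →
  (n ≤ d →
    (n ≡ 1 → IsGp 3 d (Grid n) 2)
    × (2 ≤ n → IsGp 3 d (Grid n) (n ⊓ 3)))
  × (d + 1 ≤ n →
    (d ≡ 2 → IsGp 3 d (Grid n) (2 * (n / 2) + 2 * ((n % 2) ⊓ 1)))
    × (3 ≤ d → IsGp 3 d (Grid n) (3 * (n / d) + ((n % d) ⊓ 3))))
theorem6p4 d n _ _ =
  (λ n≤d → (λ { refl → gp-n≡1 d }) , λ 2≤n → gp-n≤d d n 2≤n n≤d) ,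
  (λ d+1≤n → (λ { refl → gp-d≡2 n }) , λ 3≤d → gp-d≥3 d n 3≤d (subst (_≤ n) (+-comm d 1) d+1≤n))
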